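{- Let $p,q\in\mathbb{N}$, $J=\begin{pmatrix}I_{p\times p}&0\\0&-I_{q\times q}\end{pmatrix}$, and $O_{(p,q)}(\mathbb{Z})=\{A\in M_{p+q}(\mathbb{Z})\mid A^tJA=J\}$. Let $r_1,\ldots,r_{p+q}$ be distinct primes. Then the maps \[O_{(p,q)}(\mathbb{Z})\longrightarrow\prod_{i=1}^{p+q}\mathbb{PF}^{p+q-1}_{r_i}\] given by $A=[a_{i,j}]\mapsto\big([a_{1,1}:\cdots:a_{1,p+q}],\ldots,[a_{p+q,1}:\cdots:a_{p+q,p+q}]\big)$ (rows) and by $A\mapsto\big([a_{1,1}:\cdots:a_{p+q,1}],\ldots,[a_{1,p+q}:\cdots:a_{p+q,p+q}]\big)$ (columns) are both not surjective.
   Context: $\mathbb{PF}^{n}_{r}$ denotes the usual $n$-dimensional projective space over $\mathbb{F}_r$, i.e. the set of $(n+1)$-tuples of integers generating the unit ideal modulo the relation $(a_i)\sim(b_i)$ iff there is $\lambda$ with $\lambda\not\equiv0\bmod r$ and $a_i\equiv\lambda b_i\bmod r$ for all $i$; classes are written $[a_0:\cdots:a_n]$. -}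

module Defs where

open import Data.Nat using (ℕ; zero; suc)
open import Data.Nat.Primality using (Prime)
open import Data.Fin using (Fin; zero; suc; splitAt; _≟_)
open import Data.Integer using (ℤ; +_; _+_; _*_; _-_; -_; 0ℤ; 1ℤ)
open import Data.Integer.Divisibility using (_∣_)
open import Data.Sum using (inj₁; inj₂)
open import Data.Product using (Σ; ∃; _×_; proj₁)
open import Relation.Nullary using (¬_; yes; no)
open import Relation.Binary.PropositionalEquality using (_≡_)
open import Function.Definitions using (Injective)

∑ : ∀ {n} → (Fin n → ℤ) → ℤ
∑ {zero}  f = 0ℤ
∑ {suc n} f = f zero + ∑ (λ i → f (suc i))

Mat : ℕ → Set
Mat n = Fin n → Fin n → ℤ

transpose : ∀ {n} → Mat n → Mat n
transpose A i j = A j i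

_⊗_ : ∀ {n} → Mat n → Mat n → Mat n
(A ⊗ B) i j = ∑ (λ k → A i k * B k j)

J : (p q : ℕ) → Mat (p Data.Nat.+ q)
J p q i j with i ≟ j
... | no _ = 0ℤ
... | yes _ with splitAt p i
...   | inj₁ _ = 1ℤ
...   | inj₂ _ = - 1ℤ

IsO : (p q : ℕ) → Mat (p Data.Nat.+ q) → Set
IsO p q A = ∀ i j → (transpose A ⊗ (J p q ⊗ A)) i j ≡ J p q i j

-- representatives of points of PF^{n-1}_r: n-tuples of integers generating the
-- unit ideal of Z (some Z-linear combination equals 1)
Primitive : ∀ {n} → (Fin n → ℤ) → Set
Primitive {n} a = ∃ λ (c : Fin n → ℤ) → ∑ (λ i → c i * a i) ≡ 1ℤ

Point : ℕ → Set
Point n = Σ (Fin n → ℤ) Primitive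

-- the projective equivalence mod r
_∼⟨_⟩_ : ∀ {n} → (Fin n → ℤ) → ℕ → (Fin n → ℤ) → Set
a ∼⟨ r ⟩ b = ∃ λ (λ' : ℤ) → ¬ ((+ r) ∣ λ') × (∀ i → (+ r) ∣ (a i - λ' * b i))

row : ∀ {n} → Mat n → Fin n → (Fin n → ℤ)
row A i j = A i j

col : ∀ {n} → Mat n → Fin n → (Fin n → ℤ)
col A j i = A i j

Surjective : (p q : ℕ) → (r : Fin (p Data.Nat.+ q) → ℕ) →
             (Mat (p Data.Nat.+ q) → Fin (p Data.Nat.+ q) → Fin (p Data.Nat.+ q) → ℤ) → Set
Surjective p q r v =
  (P : Fin (p Data.Nat.+ q) → Point (p Data.Nat.+ q)) →
  ∃ λ (A : Mat (p Data.Nat.+ q)) → IsO p q A × (∀ i → v A i ∼⟨ r i ⟩ proj₁ (P i))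

{-# OPTIONS --safe #-}
-- Write Q(x) = Σₖ Jₖₖ xₖ². The columns of A ∈ O_(p,q)(ℤ) satisfy Q = ±1, and so do its rows: the
-- left inverse J Aᵗ J of A is also a right inverse, because modulo every m the map x ↦ A x is an
-- injective, hence surjective, self-map of the finite set (ℤ/m)ⁿ. Now ask for the class of eₐ + e_b
-- in every factor. If Jₐₐ = −J_bb, a lift w ≡ λ(eₐ + e_b) mod r has Q(w) ≡ λ²(Jₐₐ + J_bb) = 0, so
-- r ∣ ±1. If Q is definite, λ ≢ 0 forces wₐ, w_b ≠ 0 and then |Q(w)| = Σ wₖ² ≥ 2.
module Submission where

open import Defs
open import Data.Nat as ℕ using (ℕ; zero; suc; NonZero; z≤n; s≤s)
import Data.Nat.Properties as ℕ
import Data.Nat.Divisibility as ℕ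
open import Data.Nat.Primality using (Prime; ¬prime[1])
open import Data.Fin as Fin using (Fin; zero; suc; splitAt; _↑ʳ_; punchIn; punchOut; toℕ; fromℕ<; funToFin; finToFun)
import Data.Fin.Properties as Fin
open import Data.Integer as ℤ using (ℤ; +_; _+_; _*_; _-_; -_; 0ℤ; 1ℤ; -1ℤ; ∣_∣; _≤_)
import Data.Integer.Properties as ℤ
open import Data.Integer.DivMod using (_%ℕ_; _/ℕ_; n%ℕd<d; a≡a%ℕn+[a/ℕn]*n)
open import Data.Integer.Divisibility.Signed as Signed using (divides)
open import Data.Integer.Tactic.RingSolver using (solve-∀)
open import Algebra.Properties.Semiring.Sum ℤ.+-*-semiring using (sum; sum-cong-≗; sum-remove; sum-replicate-zero; ∑-comm; *-distribˡ-sum; *-distribʳ-sum)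
open import Data.Vec.Functional using (removeAt)
open import Data.Product using (Σ; ∃; _×_; _,_; proj₁; proj₂)
open import Data.Sum using (inj₁; inj₂; [_,_]′)
open import Function using (_∘_; const)
open import Function.Definitions using (Injective; StrictlySurjective)
open import Relation.Binary.PropositionalEquality hiding (J)
open import Relation.Nullary using (¬_; Dec; yes; no; contradiction)
open import Relation.Binary.Bundles using (Setoid)
import Relation.Binary.Reasoning.Setoid as SetoidReasoning
open import Level using (0ℓ)

∑≡sum : ∀ {n} (f : Fin n → ℤ) → ∑ f ≡ sum f
∑≡sum {zero}  f = refl
∑≡sum {suc n} f = cong (_+_ (f zero)) (∑≡sum (f ∘ suc))

∑-cong : ∀ {n} {f g : Fin n → ℤ} → f ≗ g → ∑ f ≡ ∑ g
∑-cong {f = f} {g} f≗g = trans (∑≡sum f) (trans (sum-cong-≗ f≗g) (sym (∑≡sum g)))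

*-distribˡ-∑ : ∀ {n} c (f : Fin n → ℤ) → c * ∑ f ≡ ∑ (λ i → c * f i)
*-distribˡ-∑ c f = trans (cong (c *_) (∑≡sum f)) (trans (*-distribˡ-sum c f) (sym (∑≡sum (λ i → c * f i))))

*-distribʳ-∑ : ∀ {n} c (f : Fin n → ℤ) → ∑ f * c ≡ ∑ (λ i → f i * c)
*-distribʳ-∑ c f = trans (cong (_* c) (∑≡sum f)) (trans (*-distribʳ-sum c f) (sym (∑≡sum (λ i → f i * c))))

∑-swap : ∀ {m n} (f : Fin m → Fin n → ℤ) → ∑ (λ i → ∑ (f i)) ≡ ∑ (λ j → ∑ (λ i → f i j))
∑-swap f = begin
  ∑ (λ i → ∑ (f i))               ≡⟨ ∑-cong (∑≡sum ∘ f) ⟩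
  ∑ (λ i → sum (f i))             ≡⟨ ∑≡sum (λ i → sum (f i)) ⟩
  sum (λ i → sum (f i))           ≡⟨ ∑-comm f ⟩
  sum (λ j → sum (λ i → f i j))   ≡⟨ ∑≡sum (λ j → sum (λ i → f i j)) ⟨
  ∑ (λ j → sum (λ i → f i j))     ≡⟨ ∑-cong (λ j → ∑≡sum (λ i → f i j)) ⟨
  ∑ (λ j → ∑ (λ i → f i j))       ∎
  where open ≡-Reasoning

∑-remove : ∀ {n} (f : Fin (suc n) → ℤ) i → ∑ f ≡ f i + ∑ (removeAt f i)
∑-remove f i = trans (∑≡sum f) (trans (sum-remove f) (cong (_+_ (f i)) (sym (∑≡sum (removeAt f i)))))

∑-zero : ∀ {n} {f : Fin n → ℤ} → (∀ i → f i ≡ 0ℤ) → ∑ f ≡ 0ℤ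
∑-zero {n} f≗0 = trans (∑-cong f≗0) (trans (∑≡sum {n} (const 0ℤ)) (sum-replicate-zero n))

∑-single : ∀ {n} (f : Fin n → ℤ) i → (∀ j → j ≢ i → f j ≡ 0ℤ) → ∑ f ≡ f i
∑-single {suc n} f i f≡0 = begin
  ∑ f                       ≡⟨ ∑-remove f i ⟩
  f i + ∑ (removeAt f i)    ≡⟨ cong (_+_ (f i)) (∑-zero (λ j → f≡0 (punchIn i j) (Fin.punchInᵢ≢i i j))) ⟩
  f i + 0ℤ                  ≡⟨ ℤ.+-identityʳ (f i) ⟩
  f i                       ∎
  where open ≡-Reasoning

∑-pair : ∀ {n} (f : Fin n → ℤ) {a b} → a ≢ b → (∀ j → j ≢ a → j ≢ b → f j ≡ 0ℤ) → ∑ f ≡ f a + f b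
∑-pair {suc n} f {a} {b} a≢b f≡0 = begin
  ∑ f                                   ≡⟨ ∑-remove f a ⟩
  f a + ∑ (removeAt f a)                ≡⟨ cong (_+_ (f a)) (∑-single (removeAt f a) b′ rest≡0) ⟩
  f a + f (punchIn a b′)                ≡⟨ cong (λ k → f a + f k) (Fin.punchIn-punchOut a≢b) ⟩
  f a + f b                             ∎
  where
  open ≡-Reasoning
  b′ : Fin n
  b′ = punchOut a≢b
  rest≡0 : ∀ j → j ≢ b′ → f (punchIn a j) ≡ 0ℤ
  rest≡0 j j≢b′ = f≡0 (punchIn a j) (Fin.punchInᵢ≢i a j)
    (λ e → j≢b′ (Fin.punchIn-injective a j b′ (trans e (sym (Fin.punchIn-punchOut a≢b)))))

∑-nonneg : ∀ {n} {f : Fin n → ℤ} → (∀ i → 0ℤ ≤ f i) → 0ℤ ≤ ∑ f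
∑-nonneg {zero}  _  = ℤ.≤-refl
∑-nonneg {suc n} f≥0 = ℤ.+-mono-≤ (f≥0 zero) (∑-nonneg (f≥0 ∘ suc))

single≤∑ : ∀ {n} {f : Fin n → ℤ} → (∀ i → 0ℤ ≤ f i) → ∀ a → f a ≤ ∑ f
single≤∑ {suc n} {f} f≥0 a = begin
  f a                     ≡⟨ ℤ.+-identityʳ (f a) ⟨
  f a + 0ℤ                ≤⟨ ℤ.+-monoʳ-≤ (f a) (∑-nonneg (f≥0 ∘ punchIn a)) ⟩
  f a + ∑ (removeAt f a)  ≡⟨ ∑-remove f a ⟨
  ∑ f                     ∎
  where open ℤ.≤-Reasoning

pair≤∑ : ∀ {n} {f : Fin n → ℤ} → (∀ i → 0ℤ ≤ f i) → ∀ {a b} → a ≢ b → f a + f b ≤ ∑ f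
pair≤∑ {suc n} {f} f≥0 {a} {b} a≢b = begin
  f a + f b                          ≡⟨ cong (λ k → f a + f k) (Fin.punchIn-punchOut a≢b) ⟨
  f a + f (punchIn a (punchOut a≢b)) ≤⟨ ℤ.+-monoʳ-≤ (f a) (single≤∑ (f≥0 ∘ punchIn a) (punchOut a≢b)) ⟩
  f a + ∑ (removeAt f a)             ≡⟨ ∑-remove f a ⟨
  ∑ f                                ∎
  where open ℤ.≤-Reasoning

δ : ∀ {n} → Fin n → Fin n → ℤ
δ i j with i Fin.≟ j
... | yes _ = 1ℤ
... | no  _ = 0ℤ

δ-refl : ∀ {n} (i : Fin n) → δ i i ≡ 1ℤ
δ-refl i with i Fin.≟ i
... | yes _   = refl
... | no  i≢i = contradiction refl i≢i

δ-≢ : ∀ {n} {i j : Fin n} → i ≢ j → δ i j ≡ 0ℤ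
δ-≢ {i = i} {j} i≢j with i Fin.≟ j
... | yes i≡j = contradiction i≡j i≢j
... | no  _   = refl

δ-*-diag : ∀ {n} (i j : Fin n) (f : Fin n → ℤ) → δ i j * f j ≡ δ i j * f i
δ-*-diag i j f with i Fin.≟ j
... | yes refl = refl
... | no  _    = refl

∑-δˡ : ∀ {n} (i : Fin n) (f : Fin n → ℤ) → ∑ (λ j → δ i j * f j) ≡ f i
∑-δˡ i f = trans (∑-single _ i (λ j j≢i → cong (_* f j) (δ-≢ (j≢i ∘ sym))))
                 (trans (cong (_* f i) (δ-refl i)) (ℤ.*-identityˡ (f i)))

∑-δʳ : ∀ {n} (i : Fin n) (f : Fin n → ℤ) → ∑ (λ j → f j * δ j i) ≡ f i
∑-δʳ i f = trans (∑-single _ i (λ j j≢i → trans (cong (f j *_) (δ-≢ j≢i)) (ℤ.*-zeroʳ (f j))))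
                 (trans (cong (f i *_) (δ-refl i)) (ℤ.*-identityʳ (f i)))

infixr 7 _·_

_·_ : ∀ {n} → Mat n → (Fin n → ℤ) → Fin n → ℤ
(A · u) i = ∑ (λ k → A i k * u k)

⊗-· : ∀ {n} (A B : Mat n) (u : Fin n → ℤ) i → ((A ⊗ B) · u) i ≡ (A · B · u) i
⊗-· A B u i = begin
  ∑ (λ k → ∑ (λ l → A i l * B l k) * u k)        ≡⟨ ∑-cong (λ k → *-distribʳ-∑ (u k) (λ l → A i l * B l k)) ⟩
  ∑ (λ k → ∑ (λ l → A i l * B l k * u k))        ≡⟨ ∑-swap (λ k l → A i l * B l k * u k) ⟩
  ∑ (λ l → ∑ (λ k → A i l * B l k * u k))        ≡⟨ ∑-cong (λ l → ∑-cong (λ k → ℤ.*-assoc (A i l) (B l k) (u k))) ⟩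
  ∑ (λ l → ∑ (λ k → A i l * (B l k * u k)))      ≡⟨ ∑-cong (λ l → *-distribˡ-∑ (A i l) (λ k → B l k * u k)) ⟨
  ∑ (λ l → A i l * ∑ (λ k → B l k * u k))        ∎
  where open ≡-Reasoning

infix 4 _≡_mod_

-- A record rather than a definition, so that x and y can be inferred from a proof.
record _≡_mod_ (x y : ℤ) (m : ℕ) : Set where
  constructor ≡-mod
  field divides-difference : + m Signed.∣ (x - y)

open _≡_mod_ using (divides-difference)

module _ {m : ℕ} where

  ≡⇒≡-mod : ∀ {x y} → x ≡ y → x ≡ y mod m
  ≡⇒≡-mod {x} refl = ≡-mod (divides 0ℤ (trans (ℤ.+-inverseʳ x) (sym (ℤ.*-zeroˡ (+ m)))))

  ≡-mod-sym : ∀ {x y} → x ≡ y mod m → y ≡ x mod m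
  ≡-mod-sym {x} {y} (≡-mod m∣x-y) = ≡-mod (subst (+ m Signed.∣_) (negate x y) (Signed.∣m⇒∣-m m∣x-y))
    where
    negate : ∀ x y → - (x - y) ≡ y - x
    negate = solve-∀

  ≡-mod-trans : ∀ {x y z} → x ≡ y mod m → y ≡ z mod m → x ≡ z mod m
  ≡-mod-trans {x} {y} {z} (≡-mod m∣x-y) (≡-mod m∣y-z) =
    ≡-mod (subst (+ m Signed.∣_) (telescope x y z) (Signed.∣m∣n⇒∣m+n m∣x-y m∣y-z))
    where
    telescope : ∀ x y z → (x - y) + (y - z) ≡ x - z
    telescope = solve-∀

  +-cong-mod : ∀ {x y u v} → x ≡ y mod m → u ≡ v mod m → x + u ≡ y + v mod m
  +-cong-mod {x} {y} {u} {v} (≡-mod m∣x-y) (≡-mod m∣u-v) =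
    ≡-mod (subst (+ m Signed.∣_) (regroup x y u v) (Signed.∣m∣n⇒∣m+n m∣x-y m∣u-v))
    where
    regroup : ∀ x y u v → (x - y) + (u - v) ≡ (x + u) - (y + v)
    regroup = solve-∀

  *-cong-mod : ∀ {x y u v} → x ≡ y mod m → u ≡ v mod m → x * u ≡ y * v mod m
  *-cong-mod {x} {y} {u} {v} (≡-mod m∣x-y) (≡-mod m∣u-v) =
    ≡-mod (subst (+ m Signed.∣_) (regroup x y u v) (Signed.∣m∣n⇒∣m+n (Signed.∣m⇒∣m*n u m∣x-y) (Signed.∣n⇒∣m*n y m∣u-v)))
    where
    regroup : ∀ x y u v → (x - y) * u + y * (u - v) ≡ x * u - y * v
    regroup = solve-∀

  ∑-cong-mod : ∀ {n} {f g : Fin n → ℤ} → (∀ i → f i ≡ g i mod m) → ∑ f ≡ ∑ g mod m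
  ∑-cong-mod {zero}  _   = ≡⇒≡-mod refl
  ∑-cong-mod {suc n} f≡g = +-cong-mod (f≡g zero) (∑-cong-mod (f≡g ∘ suc))

  ·-cong-mod : ∀ {n} (A : Mat n) {u v : Fin n → ℤ} → (∀ k → u k ≡ v k mod m) → ∀ i → (A · u) i ≡ (A · v) i mod m
  ·-cong-mod A u≡v i = ∑-cong-mod (λ k → *-cong-mod (≡⇒≡-mod {x = A i k} refl) (u≡v k))

  mod-setoid : Setoid 0ℓ 0ℓ
  mod-setoid = record
    { Carrier       = ℤ
    ; _≈_           = _≡_mod m
    ; isEquivalence = record { refl = ≡⇒≡-mod refl ; sym = ≡-mod-sym ; trans = ≡-mod-trans }
    }

multiple<⇒0 : ∀ {m x} → + m Signed.∣ x → ∣ x ∣ ℕ.< m → x ≡ 0ℤ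
multiple<⇒0 {m} {x} m∣x ∣x∣<m with ∣ x ∣ in eq
... | zero  = ℤ.∣i∣≡0⇒i≡0 eq
... | suc _ = contradiction (subst (m ℕ.∣_) eq (Signed.∣⇒∣ᵤ m∣x)) (ℕ.>⇒∤ ∣x∣<m)

≡-mod-all⇒≡ : ∀ {x y} → (∀ m .{{_ : NonZero m}} → x ≡ y mod m) → x ≡ y
≡-mod-all⇒≡ {x} {y} x≡y = ℤ.i-j≡0⇒i≡j x y (multiple<⇒0 (divides-difference (x≡y (suc ∣ x - y ∣))) (ℕ.n<1+n ∣ x - y ∣))

module Residues (m : ℕ) .{{_ : NonZero m}} where

  reduce : ℤ → Fin m
  reduce x = fromℕ< (n%ℕd<d x m)

  lift : Fin m → ℤ
  lift a = + toℕ a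

  reduce-≡⇒≡-mod : ∀ {x y} → reduce x ≡ reduce y → x ≡ y mod m
  reduce-≡⇒≡-mod {x} {y} eq = ≡-mod (divides (x /ℕ m - y /ℕ m) (begin
    x - y                                                           ≡⟨ cong₂ _-_ (a≡a%ℕn+[a/ℕn]*n x m) (a≡a%ℕn+[a/ℕn]*n y m) ⟩
    (+ (x %ℕ m) + x /ℕ m * + m) - (+ (y %ℕ m) + y /ℕ m * + m)       ≡⟨ cong (λ r → (+ r + x /ℕ m * + m) - (+ (y %ℕ m) + y /ℕ m * + m)) x%m≡y%m ⟩
    (+ (y %ℕ m) + x /ℕ m * + m) - (+ (y %ℕ m) + y /ℕ m * + m)       ≡⟨ cancel (+ (y %ℕ m)) (x /ℕ m) (y /ℕ m) (+ m) ⟩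
    (x /ℕ m - y /ℕ m) * + m                                         ∎))
    where
    open ≡-Reasoning
    x%m≡y%m : x %ℕ m ≡ y %ℕ m
    x%m≡y%m = trans (sym (Fin.toℕ-fromℕ< (n%ℕd<d x m))) (trans (cong toℕ eq) (Fin.toℕ-fromℕ< (n%ℕd<d y m)))
    cancel : ∀ r a b c → (r + a * c) - (r + b * c) ≡ (a - b) * c
    cancel = solve-∀

  lift-≡-mod⇒≡ : ∀ {a b} → lift a ≡ lift b mod m → a ≡ b
  lift-≡-mod⇒≡ {a} {b} (≡-mod m∣a-b) = Fin.toℕ-injective (ℤ.+-injective (ℤ.i-j≡0⇒i≡j (lift a) (lift b) (multiple<⇒0 m∣a-b ∣a-b∣<m)))
    where
    ∣a-b∣<m : ∣ lift a - lift b ∣ ℕ.< m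
    ∣a-b∣<m = subst (ℕ._< m) (cong ∣_∣ (sym (ℤ.m-n≡m⊖n (toℕ a) (toℕ b))))
                (ℕ.≤-<-trans (ℤ.∣m⊝n∣≤m⊔n (toℕ a) (toℕ b)) (ℕ.⊔-lub (Fin.toℕ<n a) (Fin.toℕ<n b)))

injective⇒strictlySurjective : ∀ {N} {f : Fin N → Fin N} → Injective _≡_ _≡_ f → StrictlySurjective _≡_ f
injective⇒strictlySurjective {suc N} {f} f-injective y with Fin.any? (λ x → f x Fin.≟ y)
... | yes fx≡y = fx≡y
... | no  ∄x   = contradiction (Fin.injective⇒≤ g-injective) ℕ.1+n≰n
  where
  fx≢y : ∀ x → y ≢ f x
  fx≢y x y≡fx = ∄x (x , sym y≡fx)
  g : Fin (suc N) → Fin N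
  g x = punchOut (fx≢y x)
  g-injective : Injective _≡_ _≡_ g
  g-injective = f-injective ∘ Fin.punchOut-injective (fx≢y _) (fx≢y _)

funToFin-cong : ∀ {m n} {f g : Fin m → Fin n} → f ≗ g → funToFin f ≡ funToFin g
funToFin-cong {zero}  _   = refl
funToFin-cong {suc m} f≗g = cong₂ Fin.combine (f≗g zero) (funToFin-cong (f≗g ∘ suc))

funToFin-injective : ∀ {m n} {f g : Fin m → Fin n} → funToFin f ≡ funToFin g → f ≗ g
funToFin-injective {m} {n} {f} {g} eq i = begin
  f i                               ≡⟨ Fin.finToFun-funToFin f i ⟨
  finToFun {n} {m} (funToFin f) i   ≡⟨ cong (λ c → finToFun c i) eq ⟩
  finToFun {n} {m} (funToFin g) i   ≡⟨ Fin.finToFun-funToFin g i ⟩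
  g i                               ∎
  where open ≡-Reasoning

≗-injective⇒≗-surjective : ∀ {m n} (φ : (Fin n → Fin m) → Fin n → Fin m) →
                           (∀ {x y} → φ x ≗ φ y → x ≗ y) → ∀ y → ∃ λ x → φ x ≗ y
≗-injective⇒≗-surjective {m} {n} φ φ-injective y =
  finToFun c , funToFin-injective (proj₂ (injective⇒strictlySurjective ψ-injective (funToFin y)))
  where
  ψ : Fin (m ℕ.^ n) → Fin (m ℕ.^ n)
  ψ c = funToFin (φ (finToFun {m} {n} c))
  ψ-injective : Injective _≡_ _≡_ ψ
  ψ-injective {c} {c′} eq = begin
    c                                 ≡⟨ Fin.funToFin-finToFin {n} {m} c ⟨
    funToFin (finToFun {m} {n} c)     ≡⟨ funToFin-cong (φ-injective (funToFin-injective eq)) ⟩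
    funToFin (finToFun {m} {n} c′)    ≡⟨ Fin.funToFin-finToFin {n} {m} c′ ⟩
    c′                                ∎
    where open ≡-Reasoning
  c : Fin (m ℕ.^ n)
  c = proj₁ (injective⇒strictlySurjective ψ-injective (funToFin y))

module LeftInverse {n} (A B : Mat n) (B·A·u≡u : ∀ u i → (B · A · u) i ≡ u i) where

  surjective-mod : ∀ m .{{_ : NonZero m}} (v : Fin n → ℤ) → ∃ λ u → ∀ i → (A · u) i ≡ v i mod m
  surjective-mod m v = lift ∘ x , reduce-≡⇒≡-mod ∘ φx≗v
    where
    open Residues m
    -- B undoes A modulo m, so x ↦ A x is injective on (ℤ/m)ⁿ.
    φ : (Fin n → Fin m) → Fin n → Fin m
    φ x = reduce ∘ (A · (lift ∘ x))
    φ-injective : ∀ {x y} → φ x ≗ φ y → x ≗ y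
    φ-injective {x} {y} φx≗φy k = lift-≡-mod⇒≡ (begin
      lift (x k)                ≡⟨ B·A·u≡u (lift ∘ x) k ⟨
      (B · A · (lift ∘ x)) k    ≈⟨ ·-cong-mod B (reduce-≡⇒≡-mod ∘ φx≗φy) k ⟩
      (B · A · (lift ∘ y)) k    ≡⟨ B·A·u≡u (lift ∘ y) k ⟩
      lift (y k)                ∎)
      where open SetoidReasoning mod-setoid
    x : Fin n → Fin m
    x = proj₁ (≗-injective⇒≗-surjective φ φ-injective (reduce ∘ v))
    φx≗v : φ x ≗ reduce ∘ v
    φx≗v = proj₂ (≗-injective⇒≗-surjective φ φ-injective (reduce ∘ v))

  A·B·v≡v-mod : ∀ m .{{_ : NonZero m}} v i → (A · B · v) i ≡ v i mod m
  A·B·v≡v-mod m v i = begin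
    (A · B · v) i          ≈⟨ ·-cong-mod A (·-cong-mod B (≡-mod-sym ∘ A·u≡v)) i ⟩
    (A · B · A · u) i      ≡⟨ ∑-cong (λ k → cong (A i k *_) (B·A·u≡u u k)) ⟩
    (A · u) i              ≈⟨ A·u≡v i ⟩
    v i                    ∎
    where
    open SetoidReasoning mod-setoid
    u : Fin n → ℤ
    u = proj₁ (surjective-mod m v)
    A·u≡v : ∀ i → (A · u) i ≡ v i mod m
    A·u≡v = proj₂ (surjective-mod m v)

  A·B·v≡v : ∀ v i → (A · B · v) i ≡ v i
  A·B·v≡v v i = ≡-mod-all⇒≡ (λ m → A·B·v≡v-mod m v i)

⊗-inverseˡ⇒inverseʳ : ∀ {n} (A B : Mat n) → (∀ i j → (B ⊗ A) i j ≡ δ i j) → ∀ i j → (A ⊗ B) i j ≡ δ i j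
⊗-inverseˡ⇒inverseʳ A B B⊗A≡δ i j = begin
  (A ⊗ B) i j                    ≡⟨ ∑-cong (λ k → cong (A i k *_) (∑-δʳ j (B k))) ⟨
  (A · B · (λ l → δ l j)) i      ≡⟨ A·B·v≡v (λ l → δ l j) i ⟩
  δ i j                          ∎
  where
  open ≡-Reasoning
  B·A·u≡u : ∀ u i → (B · A · u) i ≡ u i
  B·A·u≡u u i = begin
    (B · A · u) i                  ≡⟨ ⊗-· B A u i ⟨
    ((B ⊗ A) · u) i                ≡⟨ ∑-cong (λ k → cong (_* u k) (B⊗A≡δ i k)) ⟩
    ∑ (λ k → δ i k * u k)          ≡⟨ ∑-δˡ i u ⟩
    u i                            ∎
  open LeftInverse A B B·A·u≡u

sgn : ∀ p q → Fin (p ℕ.+ q) → ℤ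
sgn p q i = J p q i i

sgn-splitAt : ∀ p q i → sgn p q i ≡ [ const 1ℤ , const -1ℤ ]′ (splitAt p i)
sgn-splitAt p q i with i Fin.≟ i
... | no  i≢i = contradiction refl i≢i
... | yes _ with splitAt p i
...   | inj₁ _ = refl
...   | inj₂ _ = refl

J-≢ : ∀ p q {i j} → i ≢ j → J p q i j ≡ 0ℤ
J-≢ p q {i} {j} i≢j with i Fin.≟ j
... | yes i≡j = contradiction i≡j i≢j
... | no  _   = refl

J≡δ*sgn : ∀ p q i j → J p q i j ≡ δ i j * sgn p q i
J≡δ*sgn p q i j = by-cases (i Fin.≟ j)
  where
  by-cases : Dec (i ≡ j) → J p q i j ≡ δ i j * sgn p q i
  by-cases (yes refl) = sym (trans (cong (_* sgn p q i) (δ-refl i)) (ℤ.*-identityˡ (sgn p q i)))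
  by-cases (no  i≢j)  = trans (J-≢ p q i≢j) (sym (trans (cong (_* sgn p q i) (δ-≢ i≢j)) (ℤ.*-zeroˡ (sgn p q i))))

sgn-↑ʳ : ∀ p q j → sgn p q (p ↑ʳ j) ≡ -1ℤ
sgn-↑ʳ p q j = trans (sgn-splitAt p q (p ↑ʳ j)) (cong [ const 1ℤ , const -1ℤ ]′ (Fin.splitAt-↑ʳ p q j))

sgn-positive : ∀ p i → sgn p 0 i ≡ 1ℤ
sgn-positive p i rewrite sgn-splitAt p 0 i with splitAt p i
... | inj₁ _ = refl

sgn-negative : ∀ q i → sgn 0 q i ≡ -1ℤ
sgn-negative q i = sgn-splitAt 0 q i

sgn*sgn≡1 : ∀ p q i → sgn p q i * sgn p q i ≡ 1ℤ
sgn*sgn≡1 p q i rewrite sgn-splitAt p q i with splitAt p i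
... | inj₁ _ = refl
... | inj₂ _ = refl

∣sgn∣≡1 : ∀ p q i → ∣ sgn p q i ∣ ≡ 1
∣sgn∣≡1 p q i rewrite sgn-splitAt p q i with splitAt p i
... | inj₁ _ = refl
... | inj₂ _ = refl

bilinear : ∀ {n} → (Fin n → ℤ) → (Fin n → ℤ) → (Fin n → ℤ) → ℤ
bilinear s u v = ∑ (λ k → u k * (s k * v k))

quadratic : ∀ {n} → (Fin n → ℤ) → (Fin n → ℤ) → ℤ
quadratic s u = bilinear s u u

IsOrthogonal : ∀ {n} → (Fin n → ℤ) → Mat n → Set
IsOrthogonal s A = ∀ i j → bilinear s (col A i) (col A j) ≡ δ i j * s i

IsO⇒IsOrthogonal : ∀ p q A → IsO p q A → IsOrthogonal (sgn p q) A
IsO⇒IsOrthogonal p q A A∈O i j = begin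
  bilinear (sgn p q) (col A i) (col A j)   ≡⟨ ∑-cong (λ k → cong (A k i *_) (J⊗A≡sgn*A k)) ⟨
  (transpose A ⊗ (J p q ⊗ A)) i j          ≡⟨ A∈O i j ⟩
  J p q i j                                ≡⟨ J≡δ*sgn p q i j ⟩
  δ i j * sgn p q i                        ∎
  where
  open ≡-Reasoning
  J⊗A≡sgn*A : ∀ k → (J p q ⊗ A) k j ≡ sgn p q k * A k j
  J⊗A≡sgn*A k = ∑-single _ k (λ l l≢k → trans (cong (_* A l j) (J-≢ p q (l≢k ∘ sym))) (ℤ.*-zeroˡ (A l j)))

*-sign-cancel : ∀ x {t} → t * t ≡ 1ℤ → x * t * t ≡ x
*-sign-cancel x {t} t*t≡1 = trans (ℤ.*-assoc x t t) (trans (cong (x *_) t*t≡1) (ℤ.*-identityʳ x))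

IsOrthogonal-transpose : ∀ {n} {s : Fin n → ℤ} → (∀ i → s i * s i ≡ 1ℤ) →
                         ∀ A → IsOrthogonal s A → IsOrthogonal s (transpose A)
IsOrthogonal-transpose {n} {s} s*s≡1 A A-orth i j = begin
  ∑ (λ k → A i k * (s k * A j k))          ≡⟨ ∑-cong (λ k → trans (regroup (A i k) (s k) (A j k) (s j)) (*-sign-cancel _ (s*s≡1 j))) ⟨
  ∑ (λ k → A i k * B k j * s j)            ≡⟨ *-distribʳ-∑ (s j) (λ k → A i k * B k j) ⟨
  (A ⊗ B) i j * s j                        ≡⟨ cong (_* s j) (⊗-inverseˡ⇒inverseʳ A B B⊗A≡δ i j) ⟩
  δ i j * s j                              ≡⟨ δ-*-diag i j s ⟩
  δ i j * s i                              ∎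
  where
  open ≡-Reasoning
  B : Mat n
  B k l = s k * (A l k * s l)
  regroup : ∀ a σ b τ → a * (σ * (b * τ)) * τ ≡ a * (σ * b) * τ * τ
  regroup = solve-∀
  B⊗A≡δ : ∀ i j → (B ⊗ A) i j ≡ δ i j
  B⊗A≡δ i j = begin
    ∑ (λ k → s i * (A k i * s k) * A k j)          ≡⟨ ∑-cong (λ k → reassoc (s i) (A k i) (s k) (A k j)) ⟩
    ∑ (λ k → s i * (A k i * (s k * A k j)))        ≡⟨ *-distribˡ-∑ (s i) (λ k → A k i * (s k * A k j)) ⟨
    s i * bilinear s (col A i) (col A j)          ≡⟨ cong (s i *_) (A-orth i j) ⟩
    s i * (δ i j * s i)                           ≡⟨ commute (s i) (δ i j) ⟩
    δ i j * s i * s i                             ≡⟨ *-sign-cancel (δ i j) (s*s≡1 i) ⟩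
    δ i j                                         ∎
    where
    reassoc : ∀ σ a τ b → σ * (a * τ) * b ≡ σ * (a * (τ * b))
    reassoc = solve-∀
    commute : ∀ σ d → σ * (d * σ) ≡ d * σ * σ
    commute = solve-∀

IsOrthogonal⇒quadratic-col : ∀ {n} {s : Fin n → ℤ} A → IsOrthogonal s A → ∀ i → quadratic s (col A i) ≡ s i
IsOrthogonal⇒quadratic-col {s = s} A A-orth i = trans (A-orth i i) (trans (cong (_* s i) (δ-refl i)) (ℤ.*-identityˡ (s i)))

ePair : ∀ {n} → Fin n → Fin n → Fin n → ℤ
ePair a b j = δ a j + δ b j

module _ {n} {a b : Fin n} (a≢b : a ≢ b) where

  ePair-left : ePair a b a ≡ 1ℤ
  ePair-left = cong₂ _+_ (δ-refl a) (δ-≢ (a≢b ∘ sym))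

  ePair-right : ePair a b b ≡ 1ℤ
  ePair-right = cong₂ _+_ (δ-≢ a≢b) (δ-refl b)

  ePair-point : Point n
  ePair-point = ePair a b , δ a , trans (∑-δˡ a (ePair a b)) ePair-left

  quadratic-ePair : ∀ s → quadratic s (ePair a b) ≡ s a + s b
  quadratic-ePair s = trans (∑-pair _ a≢b outside≡0) (cong₂ _+_ (at1 ePair-left) (at1 ePair-right))
    where
    outside≡0 : ∀ j → j ≢ a → j ≢ b → ePair a b j * (s j * ePair a b j) ≡ 0ℤ
    outside≡0 j j≢a j≢b rewrite δ-≢ (j≢a ∘ sym) | δ-≢ (j≢b ∘ sym) = refl
    at1 : ∀ {j} → ePair a b j ≡ 1ℤ → ePair a b j * (s j * ePair a b j) ≡ s j
    at1 {j} Pj≡1 rewrite Pj≡1 = trans (ℤ.*-identityˡ (s j * 1ℤ)) (ℤ.*-identityʳ (s j))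

quadratic-scale : ∀ {n} s (c : ℤ) (v : Fin n → ℤ) → quadratic s (λ j → c * v j) ≡ c * c * quadratic s v
quadratic-scale s c v = trans (∑-cong (λ j → regroup c (v j) (s j))) (sym (*-distribˡ-∑ (c * c) (λ j → v j * (s j * v j))))
  where
  regroup : ∀ c x σ → c * x * (σ * (c * x)) ≡ c * c * (x * (σ * x))
  regroup = solve-∀

∼⇒≡-mod : ∀ {n r} {w v : Fin n → ℤ} (w∼v : w ∼⟨ r ⟩ v) → ∀ j → w j ≡ proj₁ w∼v * v j mod r
∼⇒≡-mod (_ , _ , r∣w-cv) j = ≡-mod (Signed.∣ᵤ⇒∣ (r∣w-cv j))

∼-nonzero : ∀ {n r} {w v : Fin n → ℤ} → w ∼⟨ r ⟩ v → ∀ {j} → v j ≡ 1ℤ → w j ≢ 0ℤ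
∼-nonzero {r = r} {w} {v} (c , r∤c , r∣w-cv) {j} vj≡1 wj≡0 =
  r∤c (subst (r ℕ.∣_) (trans (cong ∣_∣ w-cv≡-c) (ℤ.∣-i∣≡∣i∣ c)) (r∣w-cv j))
  where
  w-cv≡-c : w j - c * v j ≡ - c
  w-cv≡-c rewrite wj≡0 | vj≡1 | ℤ.*-identityʳ c = ℤ.+-identityˡ (- c)

unit≢0-mod-prime : ∀ {r x} → Prime r → ∣ x ∣ ≡ 1 → ¬ (x ≡ 0ℤ mod r)
unit≢0-mod-prime {r} {x} r-prime ∣x∣≡1 (≡-mod r∣x-0) =
  ¬prime[1] (subst Prime (ℕ.∣1⇒≡1 (subst (r ℕ.∣_) ∣x∣≡1 (Signed.∣⇒∣ᵤ r∣x))) r-prime)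
  where
  r∣x : + r Signed.∣ x
  r∣x = subst (+ r Signed.∣_) (ℤ.+-identityʳ x) r∣x-0

square-nonneg : ∀ x → 0ℤ ≤ x * x
square-nonneg (+ zero)   = ℤ.+≤+ z≤n
square-nonneg ℤ.+[1+ _ ] = ℤ.+≤+ z≤n
square-nonneg ℤ.-[1+ _ ] = ℤ.+≤+ z≤n

square-pos : ∀ {x} → x ≢ 0ℤ → 1ℤ ≤ x * x
square-pos {+ zero}   x≢0 = contradiction refl x≢0
square-pos {ℤ.+[1+ _ ]} _ = ℤ.+≤+ (s≤s z≤n)
square-pos {ℤ.-[1+ _ ]} _ = ℤ.+≤+ (s≤s z≤n)

NoUnitLift : ∀ {n} → (Fin n → ℤ) → (Fin n → ℤ) → Set
NoUnitLift s v = ∀ r w → Prime r → ∣ quadratic s w ∣ ≡ 1 → ¬ (w ∼⟨ r ⟩ v)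

isotropic⇒NoUnitLift : ∀ {n} {s : Fin n → ℤ} {a b} (a≢b : a ≢ b) → s a + s b ≡ 0ℤ → NoUnitLift s (ePair a b)
isotropic⇒NoUnitLift {s = s} {a} {b} a≢b sa+sb≡0 r w r-prime ∣Q∣≡1 w∼P@(c , _) =
  unit≢0-mod-prime r-prime ∣Q∣≡1 (begin
    quadratic s w                          ≈⟨ ∑-cong-mod (λ j → *-cong-mod (w≡cP j) (*-cong-mod (≡⇒≡-mod {x = s j} refl) (w≡cP j))) ⟩
    quadratic s (λ j → c * ePair a b j)    ≡⟨ quadratic-scale s c (ePair a b) ⟩
    c * c * quadratic s (ePair a b)        ≡⟨ cong (c * c *_) (trans (quadratic-ePair a≢b s) sa+sb≡0) ⟩
    c * c * 0ℤ                             ≡⟨ ℤ.*-zeroʳ (c * c) ⟩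
    0ℤ                                     ∎)
  where
  open SetoidReasoning mod-setoid
  w≡cP : ∀ j → w j ≡ c * ePair a b j mod r
  w≡cP = ∼⇒≡-mod w∼P

definite⇒NoUnitLift : ∀ {n} {s : Fin n → ℤ} {σ} → (∀ j → s j ≡ σ) → ∀ {a b} (a≢b : a ≢ b) → NoUnitLift s (ePair a b)
definite⇒NoUnitLift {s = s} {σ} s≡σ {a} {b} a≢b r w _ ∣Q∣≡1 w∼P = 2≰1 (subst (+ 2 ≤_) ∑squares≡1 2≤∑squares)
  where
  squares : Fin _ → ℤ
  squares j = w j * w j
  Q≡σ*∑squares : quadratic s w ≡ σ * ∑ squares
  Q≡σ*∑squares = trans (∑-cong (λ j → trans (cong (λ t → w j * (t * w j)) (s≡σ j)) (regroup (w j) σ)))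
                       (sym (*-distribˡ-∑ σ squares))
    where
    regroup : ∀ x σ → x * (σ * x) ≡ σ * (x * x)
    regroup = solve-∀
  ∑squares≡1 : ∑ squares ≡ 1ℤ
  ∑squares≡1 = trans (sym (ℤ.0≤i⇒+∣i∣≡i (∑-nonneg (square-nonneg ∘ w)))) (cong +_
    (ℕ.m*n≡1⇒n≡1 ∣ σ ∣ _ (trans (sym (ℤ.abs-* σ (∑ squares))) (trans (cong ∣_∣ (sym Q≡σ*∑squares)) ∣Q∣≡1))))
  2≤∑squares : + 2 ≤ ∑ squares
  2≤∑squares = ℤ.≤-trans (ℤ.+-mono-≤ (square-pos (∼-nonzero {w = w} {ePair a b} w∼P (ePair-left a≢b))) (square-pos (∼-nonzero {w = w} {ePair a b} w∼P (ePair-right a≢b))))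
                         (pair≤∑ (square-nonneg ∘ w) a≢b)
  2≰1 : ¬ (+ 2 ≤ 1ℤ)
  2≰1 (ℤ.+≤+ (s≤s ()))

obstruction : ∀ p q → 2 ℕ.≤ p ℕ.+ q → Σ (Point (p ℕ.+ q)) λ P → NoUnitLift (sgn p q) (proj₁ P)
obstruction (suc p) (suc q) _ =
  ePair-point a≢b , isotropic⇒NoUnitLift {s = sgn (suc p) (suc q)} a≢b (cong (_+_ 1ℤ) (sgn-↑ʳ (suc p) (suc q) zero))
  where
  a≢b : zero ≢ suc p ↑ʳ zero
  a≢b ()
obstruction zero (suc (suc q)) _ = ePair-point 0≢1 , definite⇒NoUnitLift {s = sgn 0 (suc (suc q))} (sgn-negative (suc (suc q))) 0≢1
  where
  0≢1 : zero ≢ suc zero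
  0≢1 ()
obstruction (suc (suc p)) zero _ = ePair-point 0≢1 , definite⇒NoUnitLift {s = sgn (suc (suc p)) 0} (sgn-positive (suc (suc p))) 0≢1
  where
  0≢1 : zero ≢ suc zero
  0≢1 ()
obstruction zero          zero          ()
obstruction zero          (suc zero)    (s≤s ())
obstruction (suc zero)    zero          (s≤s ())

¬surjective : ∀ p q → 2 ℕ.≤ p ℕ.+ q → (r : Fin (p ℕ.+ q) → ℕ) → (∀ i → Prime (r i)) →
              (v : Mat (p ℕ.+ q) → Fin (p ℕ.+ q) → Fin (p ℕ.+ q) → ℤ) →
              (∀ A → IsO p q A → ∀ i → ∣ quadratic (sgn p q) (v A i) ∣ ≡ 1) → ¬ Surjective p q r v
¬surjective p q 2≤n r r-prime v v-unit surj
  with P , P-obstructed ← obstruction p q 2≤n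
  with A , A∈O , vA∼P ← surj (const P)
  = P-obstructed (r i) (v A i) (r-prime i) (v-unit A A∈O i) (vA∼P i)
  where
  i : Fin (p ℕ.+ q)
  i = fromℕ< 2≤n

-- The primes need not be distinct: a single coordinate already carries the obstruction.
mainTheorem8 : (p q : ℕ) → 2 ℕ.≤ p ℕ.+ q → (r : Fin (p ℕ.+ q) → ℕ) → (∀ i → Prime (r i)) → Injective _≡_ _≡_ r
                 → ¬ Surjective p q r row × ¬ Surjective p q r col
mainTheorem8 p q 2≤n r r-prime _ = ¬surjective p q 2≤n r r-prime row row-unit , ¬surjective p q 2≤n r r-prime col col-unit
  where
  col-unit : ∀ A → IsO p q A → ∀ i → ∣ quadratic (sgn p q) (col A i) ∣ ≡ 1
  col-unit A A∈O i = trans (cong ∣_∣ (IsOrthogonal⇒quadratic-col A (IsO⇒IsOrthogonal p q A A∈O) i)) (∣sgn∣≡1 p q i)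
  row-unit : ∀ A → IsO p q A → ∀ i → ∣ quadratic (sgn p q) (row A i) ∣ ≡ 1
  row-unit A A∈O i = trans (cong ∣_∣ (IsOrthogonal⇒quadratic-col (transpose A) Aᵗ-orth i)) (∣sgn∣≡1 p q i)
    where
    Aᵗ-orth : IsOrthogonal (sgn p q) (transpose A)
    Aᵗ-orth = IsOrthogonal-transpose (sgn*sgn≡1 p q) A (IsO⇒IsOrthogonal p q A A∈O)
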